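{- Let $t$ and $\lambda$ be positive integers with $t \ge \lambda+1$ and $t \ge 3$. Then the complete digraph $\overleftrightarrow{K}_{t+\lambda}$ on $t+\lambda$ vertices is the only $(t,\lambda)$-liking digraph; that is, every $(t,\lambda)$-liking digraph is isomorphic to $\overleftrightarrow{K}_{t+\lambda}$.
   Context: All digraphs are finite, with no loops and no multiple arcs. For positive integers $t$ and $\lambda$, a digraph is a $(t,\lambda)$-liking digraph if every set of $t$ distinct vertices has exactly $\lambda$ common out-neighbors. The complete digraph $\overleftrightarrow{K}_m$ is the digraph on $m$ vertices in which, for every pair $x,y$ of distinct vertices, both arcs $(x,y)$ and $(y,x)$ are present. -}

module Defs where

open import Data.Nat using (ℕ; zero; suc)
open import Data.Bool using (Bool; true; false; _∧_; _∨_; not)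
open import Data.Fin using (Fin; _≟_)
open import Data.Fin.Subset using (Subset; ∣_∣)
open import Data.Vec using (tabulate; lookup)
open import Relation.Binary.PropositionalEquality using (_≡_)
open import Relation.Nullary.Decidable using (⌊_⌋)
open import Function.Bundles using (_⤖_; Bijection)
open import Data.Product using (_×_)

record Digraph (n : ℕ) : Set where
  field
    arc      : Fin n → Fin n → Bool
    loopless : ∀ x → arc x x ≡ false
open Digraph public

allFin : ∀ {n} → (Fin n → Bool) → Bool
allFin {zero}  p = true
allFin {suc n} p = p Fin.zero ∧ allFin (λ i → p (Fin.suc i))

commonOut : ∀ {n} → Digraph n → Subset n → Subset n
commonOut D S = tabulate λ v → allFin λ u → not (lookup S u) ∨ arc D u v

IsLiking : ∀ {n} → ℕ → ℕ → Digraph n → Set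
IsLiking t λ' D = ∀ S → ∣ S ∣ ≡ t → ∣ commonOut D S ∣ ≡ λ'

complete : (m : ℕ) → Digraph m
complete m = record
  { arc = λ x y → not ⌊ x ≟ y ⌋
  ; loopless = loopless-proof }
  where
  open import Relation.Nullary using (yes; no)
  open import Relation.Binary.PropositionalEquality using (refl)
  loopless-proof : ∀ x → not ⌊ x ≟ x ⌋ ≡ false
  loopless-proof x with x ≟ x
  ... | yes _ = refl
  ... | no ¬p with () ← ¬p refl

record _≅_ {n m : ℕ} (D : Digraph n) (E : Digraph m) : Set where
  field
    bij      : Fin n ⤖ Fin m
    preserve : ∀ x y → arc E (Bijection.to bij x) (Bijection.to bij y) ≡ arc D x y

{-# OPTIONS --safe #-}
-- A Fisher-type rank argument.  Suppose the arc (a , b) is missing and let Q ∋ a be a set of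
-- t − 2 vertices avoiding b.  Take the n integer vectors e_q (q ∈ Q) and the characteristic
-- vectors of N⁺(Q ∪ {i}) (i ∉ Q), N⁺ being the common out-neighbourhood.  All of them live on
-- Q ∪ N⁺(Q), which misses b, so they are linearly dependent.  But since every Q ∪ {i, p} is a
-- t-set, their Gram matrix is λ·u uᵀ + diag e with u the indicator of the complement of Q and
-- e > 0 (|N⁺(Q ∪ {p})| > λ), which is nonsingular.  So D is complete; then N⁺(S) is the
-- complement of S, and λ = n − t.
module Submission where

open import Defs
open import Data.Nat as ℕ using (ℕ; zero; suc; s≤s; z≤n)
import Data.Nat.Properties as ℕ
open import Data.Bool using (Bool; true; false; not; _∧_; _∨_; if_then_else_)
open import Data.Integer as ℤ using (ℤ; +_; +[1+_]; -[1+_]; 0ℤ; 1ℤ; +≤+; +<+)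
open import Data.Integer.Properties
  using (+-*-semiring; +-identityˡ; +-identityʳ; *-zeroʳ; *-identityʳ; *-assoc; neg-distribˡ-*;
         neg-distribʳ-*; ≤-refl; ≤-antisym; <⇒≤; <-irrefl; +-mono-≤; +-monoʳ-≤; i*j≡0⇒i≡0∨j≡0; pos-+; pos-*)
open import Data.Integer.Tactic.RingSolver using (solve-∀)
open import Data.Fin using (Fin; zero; suc; punchIn; _≟_)
open import Data.Fin.Properties using (punchInᵢ≢i; all?; ¬∀⟶∃¬)
open import Data.Fin.Subset using (Subset; inside; outside; _∈_; _∉_; _⊆_; ∣_∣; ⁅_⁆; _∪_; _∩_; ∁; ⊥; ⊤)
open import Data.Fin.Subset.Properties
  using (_∈?_; drop-there; ∈⊤; ⊆⊤; ⊆-antisym; p⊆p∪q; q⊆p∪q; x∈p∪q⁺; x∈p∪q⁻; x∈p∩q⁺; x∈p∩q⁻;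
         x∈⁅x⁆; x∈⁅y⁆⇒x≡y; x≢y⇒x∉⁅y⁆; x∈∁p⇒x∉p; x∉p⇒x∈∁p; ∣⊥∣≡0; ∣⊤∣≡n; ∣⁅x⁆∣≡1; ∣∁p∣≡n∸∣p∣;
         p⊂q⇒∣p∣<∣q∣; Empty-unique; ∪-identityʳ; ∩-idem; ∪-idempotentCommutativeMonoid)
open import Data.Vec using ([]; _∷_; here; there; lookup)
open import Data.Vec.Properties using ([]=⇒lookup; lookup⇒[]=; lookup-zipWith; lookup∘tabulate)
open import Data.Vec.Functional using (removeAt; insertAt)
open import Data.Vec.Functional.Properties using (insertAt-lookup; insertAt-punchIn)
open import Data.Product using (∃; ∃-syntax; _×_; _,_)
open import Data.Sum using (_⊎_; inj₁; inj₂; [_,_])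
open import Function using (_∘_)
open import Function.Construct.Identity using (⤖-id)
open import Relation.Binary.PropositionalEquality
  using (_≡_; _≢_; refl; sym; trans; cong; cong₂; subst; subst₂; module ≡-Reasoning)
open import Relation.Nullary using (¬_; yes; no; contradiction)
import Algebra.Solver.IdempotentCommutativeMonoid as ICM
open import Algebra.Properties.Semiring.Sum +-*-semiring
  using (sum; sum-cong-≗; sum-remove; ∑-distrib-+; ∑-comm; *-distribˡ-sum; *-distribʳ-sum; sum-replicate-zero)

private variable
  m n : ℕ
  p q S T : Subset n
  x y : Fin n

module IntegerLinearAlgebra where

  open import Data.Integer using (_+_; _*_; _-_; -_; _≤_; _<_)

  sum-zero : (f : Fin n → ℤ) → (∀ i → f i ≡ 0ℤ) → sum f ≡ 0ℤ
  sum-zero {n} f f≡0 = trans (sum-cong-≗ f≡0) (sum-replicate-zero n)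

  record Dependency (A : Fin m → Fin n → ℤ) : Set where
    field
      coeff       : Fin m → ℤ
      nontrivial  : ∃[ i ] coeff i ≢ 0ℤ
      annihilates : ∀ y → sum (λ i → coeff i * A i y) ≡ 0ℤ

  open Dependency

  dependency-of-zero-column : (A : Fin m → Fin (suc n) → ℤ) → (∀ i → A i zero ≡ 0ℤ) →
    Dependency (λ i y → A i (suc y)) → Dependency A
  dependency-of-zero-column A zero-col d = record
    { coeff = coeff d ; nontrivial = nontrivial d ; annihilates = annihilates′ }
    where
    annihilates′ : ∀ y → sum (λ i → coeff d i * A i y) ≡ 0ℤ
    annihilates′ zero    = sum-zero _ λ i → trans (cong (coeff d i *_) (zero-col i)) (*-zeroʳ (coeff d i))
    annihilates′ (suc y) = annihilates d y

  eliminate : (A : Fin (suc m) → Fin (suc n) → ℤ) (p : Fin (suc m)) → Fin m → Fin n → ℤ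
  eliminate A p i y = A p zero * A (punchIn p i) (suc y) - A (punchIn p i) zero * A p (suc y)

  -- The pivot row gets the coefficient that cancels column zero; on every column the
  -- combination is then the given relation among the eliminated rows.
  dependency-by-pivot : (A : Fin (suc m) → Fin (suc n) → ℤ) (p : Fin (suc m)) → A p zero ≢ 0ℤ →
    Dependency (eliminate A p) → Dependency A
  dependency-by-pivot {m} {n} A p a≢0 d = record
    { coeff = c ; nontrivial = nontrivial′ (nontrivial d) ; annihilates = annihilates′ }
    where
    a : ℤ
    a = A p zero
    B : Fin m → Fin (suc n) → ℤ
    B = removeAt A p
    s : ℤ
    s = sum λ i → coeff d i * B i zero
    c : Fin (suc m) → ℤ
    c = insertAt (λ i → a * coeff d i) p (- s)

    nontrivial′ : ∃[ i ] coeff d i ≢ 0ℤ → ∃[ j ] c j ≢ 0ℤ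
    nontrivial′ (i , dᵢ≢0) = punchIn p i , λ cⱼ≡0 →
      [ a≢0 , dᵢ≢0 ] (i*j≡0⇒i≡0∨j≡0 a (trans (sym (insertAt-punchIn _ p (- s) i)) cⱼ≡0))

    combination : ∀ y → sum (λ j → c j * A j y) ≡ sum (λ i → coeff d i * (a * B i y - B i zero * A p y))
    combination y = begin
      sum (λ j → c j * A j y)
        ≡⟨ sum-remove {i = p} (λ j → c j * A j y) ⟩
      c p * A p y + sum (λ i → c (punchIn p i) * B i y)
        ≡⟨ cong₂ (λ cₚ σ → cₚ * A p y + σ) (insertAt-lookup _ p (- s))
                 (sum-cong-≗ λ i → cong (_* B i y) (insertAt-punchIn _ p (- s) i)) ⟩
      - s * A p y + sum (λ i → a * coeff d i * B i y)
        ≡⟨ cong (_+ sum (λ i → a * coeff d i * B i y)) pivot-term ⟩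
      sum (λ i → coeff d i * B i zero * - A p y) + sum (λ i → a * coeff d i * B i y)
        ≡⟨ ∑-distrib-+ (λ i → coeff d i * B i zero * - A p y) (λ i → a * coeff d i * B i y) ⟨
      sum (λ i → coeff d i * B i zero * - A p y + a * coeff d i * B i y)
        ≡⟨ sum-cong-≗ (λ i → regroup a (coeff d i) (B i y) (B i zero) (A p y)) ⟩
      sum (λ i → coeff d i * (a * B i y - B i zero * A p y)) ∎
      where
      open ≡-Reasoning
      pivot-term : - s * A p y ≡ sum (λ i → coeff d i * B i zero * - A p y)
      pivot-term = trans (sym (neg-distribˡ-* s (A p y)))
                         (trans (neg-distribʳ-* s (A p y)) (*-distribʳ-sum (- A p y) (λ i → coeff d i * B i zero)))
      regroup : ∀ a dᵢ b b₀ aₚ → dᵢ * b₀ * - aₚ + a * dᵢ * b ≡ dᵢ * (a * b - b₀ * aₚ)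
      regroup = solve-∀

    annihilates′ : ∀ y → sum (λ j → c j * A j y) ≡ 0ℤ
    annihilates′ zero    = trans (combination zero) (sum-zero _ λ i → cancel (coeff d i) a (B i zero))
      where
      cancel : ∀ dᵢ a b₀ → dᵢ * (a * b₀ - b₀ * a) ≡ 0ℤ
      cancel = solve-∀
    annihilates′ (suc y) = trans (combination (suc y)) (annihilates d y)

  SupportedOn : (Fin m → Fin n → ℤ) → Subset n → Set
  SupportedOn A C = ∀ i y → y ∉ C → A i y ≡ 0ℤ

  tail-supportedOn : ∀ {s C} (A : Fin m → Fin (suc n) → ℤ) → SupportedOn A (s ∷ C) →
    SupportedOn (λ i y → A i (suc y)) C
  tail-supportedOn A supp i y y∉C = supp i (suc y) (y∉C ∘ drop-there)

  eliminate-supportedOn : ∀ {s C} (A : Fin (suc m) → Fin (suc n) → ℤ) (p : Fin (suc m)) →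
    SupportedOn A (s ∷ C) → SupportedOn (eliminate A p) C
  eliminate-supportedOn A p supp i y y∉C = begin
    A p zero * A (punchIn p i) (suc y) - A (punchIn p i) zero * A p (suc y)
      ≡⟨ cong₂ (λ u v → A p zero * u - A (punchIn p i) zero * v) (supp′ (punchIn p i)) (supp′ p) ⟩
    A p zero * 0ℤ - A (punchIn p i) zero * 0ℤ
      ≡⟨ vanish (A p zero) (A (punchIn p i) zero) ⟩
    0ℤ ∎
    where
    open ≡-Reasoning
    supp′ : ∀ j → A j (suc y) ≡ 0ℤ
    supp′ j = tail-supportedOn A supp j y y∉C
    vanish : ∀ a b → a * 0ℤ - b * 0ℤ ≡ 0ℤ
    vanish = solve-∀

  zero-column-or-pivot : (A : Fin m → Fin (suc n) → ℤ) → (∀ i → A i zero ≡ 0ℤ) ⊎ ∃[ p ] A p zero ≢ 0ℤ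
  zero-column-or-pivot A with all? (λ i → A i zero ℤ.≟ 0ℤ)
  ... | yes zero-col = inj₁ zero-col
  ... | no ¬zero-col = inj₂ (¬∀⟶∃¬ _ _ (λ i → A i zero ℤ.≟ 0ℤ) ¬zero-col)

  dependency : (A : Fin m → Fin n → ℤ) (C : Subset n) → SupportedOn A C → ∣ C ∣ ℕ.< m → Dependency A
  dependency {suc m} {zero} A [] _ _ = record
    { coeff = unit ; nontrivial = zero , λ () ; annihilates = λ () }
    where
    unit : Fin (suc m) → ℤ
    unit zero    = 1ℤ
    unit (suc _) = 0ℤ
  dependency {n = suc n} A (outside ∷ C) supp ∣C∣<m =
    dependency-of-zero-column A (λ i → supp i zero λ ())
      (dependency _ C (tail-supportedOn A supp) ∣C∣<m)
  dependency {zero}  {suc n} A (inside ∷ C) supp ()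
  dependency {suc m} {suc n} A (inside ∷ C) supp (s≤s ∣C∣<m) with zero-column-or-pivot A
  ... | inj₁ zero-col = dependency-of-zero-column A zero-col
          (dependency _ C (tail-supportedOn A supp) (ℕ.m≤n⇒m≤1+n ∣C∣<m))
  ... | inj₂ (p , a≢0) = dependency-by-pivot A p a≢0
          (dependency (eliminate A p) C (eliminate-supportedOn A p supp) ∣C∣<m)

  0≤i*j : ∀ {i j} → 0ℤ ≤ i → 0ℤ ≤ j → 0ℤ ≤ i * j
  0≤i*j {+ m} {+ k} _ _ = subst (0ℤ ≤_) (pos-* m k) (+≤+ z≤n)

  0≤i*i : ∀ i → 0ℤ ≤ i * i
  0≤i*i (+ zero)  = ≤-refl
  0≤i*i +[1+ m ]  = +≤+ z≤n
  0≤i*i -[1+ m ]  = +≤+ z≤n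

  0≤i→0≤j→i+j≡0⇒i≡0 : ∀ {i j} → 0ℤ ≤ i → 0ℤ ≤ j → i + j ≡ 0ℤ → i ≡ 0ℤ
  0≤i→0≤j→i+j≡0⇒i≡0 {i} {j} 0≤i 0≤j i+j≡0 =
    ≤-antisym (subst₂ _≤_ (+-identityʳ i) i+j≡0 (+-monoʳ-≤ i 0≤j)) 0≤i

  sum-nonneg : (f : Fin n → ℤ) → (∀ i → 0ℤ ≤ f i) → 0ℤ ≤ sum f
  sum-nonneg {zero}  f 0≤f = ≤-refl
  sum-nonneg {suc n} f 0≤f = +-mono-≤ (0≤f zero) (sum-nonneg (f ∘ suc) (0≤f ∘ suc))

  nonneg-sum≡0⇒≡0 : (f : Fin n → ℤ) → (∀ i → 0ℤ ≤ f i) → sum f ≡ 0ℤ → ∀ i → f i ≡ 0ℤ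
  nonneg-sum≡0⇒≡0 {suc n} f 0≤f sum≡0 i =
    0≤i→0≤j→i+j≡0⇒i≡0 (0≤f i) (sum-nonneg _ (0≤f ∘ punchIn i)) (trans (sym (sum-remove f)) sum≡0)

  i*i≡0⇒i≡0 : ∀ i → i * i ≡ 0ℤ → i ≡ 0ℤ
  i*i≡0⇒i≡0 i i*i≡0 = [ (λ i≡0 → i≡0) , (λ i≡0 → i≡0) ] (i*j≡0⇒i≡0∨j≡0 i i*i≡0)

  -- The matrix is l·u uᵀ + diag e; testing c G = 0 against c gives l (u·c)² + Σ e_p c_p² = 0.
  rank-one+positive-diagonal-nonsingular : (l : ℕ) (u e : Fin n → ℤ) (G : Fin n → Fin n → ℤ) →
    (∀ i p → i ≢ p → G i p ≡ + l * (u i * u p)) → (∀ p → G p p ≡ + l * (u p * u p) + e p) →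
    (∀ p → 0ℤ < e p) → (c : Fin n → ℤ) → (∀ p → sum (λ i → c i * G i p) ≡ 0ℤ) → ∀ p → c p ≡ 0ℤ
  rank-one+positive-diagonal-nonsingular {zero}  _ _ _ _ _ _ _ _ _ ()
  rank-one+positive-diagonal-nonsingular {suc n} l u e G off-diagonal diagonal 0<e c cG≡0 p =
    [ (λ eₚ≡0 → contradiction (0<e p) (<-irrefl (sym eₚ≡0))) , i*i≡0⇒i≡0 (c p) ]
      (i*j≡0⇒i≡0∨j≡0 (e p) (nonneg-sum≡0⇒≡0 _ (λ q → 0≤i*j (<⇒≤ (0<e q)) (0≤i*i (c q))) weighted≡0 p))
    where
    σ : ℤ
    σ = sum λ i → c i * u i

    column : ∀ p → sum (λ i → c i * G i p) ≡ σ * (+ l * u p) + c p * e p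
    column p = begin
      sum (λ i → c i * G i p)
        ≡⟨ sum-remove {i = p} (λ i → c i * G i p) ⟩
      c p * G p p + sum (λ j → c (punchIn p j) * G (punchIn p j) p)
        ≡⟨ cong₂ (λ g s → c p * g + s) (diagonal p)
             (sum-cong-≗ λ j → cong (c (punchIn p j) *_) (off-diagonal _ p (punchInᵢ≢i p j))) ⟩
      c p * (+ l * (u p * u p) + e p) + sum (λ j → c (punchIn p j) * (+ l * (u (punchIn p j) * u p)))
        ≡⟨ split (c p) (+ l * (u p * u p)) (e p) _ ⟩
      (c p * (+ l * (u p * u p)) + sum (λ j → c (punchIn p j) * (+ l * (u (punchIn p j) * u p)))) + c p * e p
        ≡⟨ cong (_+ c p * e p) (sum-remove {i = p} (λ i → c i * (+ l * (u i * u p)))) ⟨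
      sum (λ i → c i * (+ l * (u i * u p))) + c p * e p
        ≡⟨ cong (_+ c p * e p) (sum-cong-≗ λ i → regroup (c i) (+ l) (u i) (u p)) ⟩
      sum (λ i → c i * u i * (+ l * u p)) + c p * e p
        ≡⟨ cong (_+ c p * e p) (*-distribʳ-sum (+ l * u p) (λ i → c i * u i)) ⟨
      σ * (+ l * u p) + c p * e p ∎
      where
      open ≡-Reasoning
      split : ∀ c h e s → c * (h + e) + s ≡ (c * h + s) + c * e
      split = solve-∀
      regroup : ∀ c l u v → c * (l * (u * v)) ≡ c * u * (l * v)
      regroup = solve-∀

    weighted≡0 : sum (λ p → e p * (c p * c p)) ≡ 0ℤ
    weighted≡0 = 0≤i→0≤j→i+j≡0⇒i≡0
      (sum-nonneg _ λ q → 0≤i*j (<⇒≤ (0<e q)) (0≤i*i (c q)))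
      (0≤i*j {+ l} (+≤+ z≤n) (0≤i*i σ))
      (begin
        sum (λ p → e p * (c p * c p)) + + l * (σ * σ)
          ≡⟨ cong (_+_ (sum (λ p → e p * (c p * c p))))
                  (trans (sym (*-assoc (+ l) σ σ)) (*-distribˡ-sum (+ l * σ) (λ p → c p * u p))) ⟩
        sum (λ p → e p * (c p * c p)) + sum (λ p → + l * σ * (c p * u p))
          ≡⟨ ∑-distrib-+ (λ p → e p * (c p * c p)) (λ p → + l * σ * (c p * u p)) ⟨
        sum (λ p → e p * (c p * c p) + + l * σ * (c p * u p))
          ≡⟨ sum-cong-≗ (λ p → trans (regroup (c p) (e p) σ (+ l) (u p))
                                     (cong (c p *_) (trans (sym (column p)) (cG≡0 p)))) ⟩
        sum (λ p → c p * 0ℤ)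
          ≡⟨ sum-zero _ (λ p → *-zeroʳ (c p)) ⟩
        0ℤ ∎)
      where
      open ≡-Reasoning
      regroup : ∀ c e σ l u → e * (c * c) + l * σ * (c * u) ≡ c * (σ * (l * u) + c * e)
      regroup = solve-∀

  χ : Subset n → Fin n → ℤ
  χ p x = if lookup p x then 1ℤ else 0ℤ

  sum-χ : (p : Subset n) → sum (χ p) ≡ + ∣ p ∣
  sum-χ []            = refl
  sum-χ (inside ∷ p)  = cong (_+_ 1ℤ) (sum-χ p)
  sum-χ (outside ∷ p) = trans (+-identityˡ _) (sum-χ p)

  χ-∉ : x ∉ p → χ p x ≡ 0ℤ
  χ-∉ {x = x} {p} x∉p with lookup p x in eq
  ... | true  = contradiction (lookup⇒[]= x p eq) x∉p
  ... | false = refl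

  χ-∩ : (p q : Subset n) (x : Fin n) → χ (p ∩ q) x ≡ χ p x * χ q x
  χ-∩ p q x rewrite lookup-zipWith _∧_ x p q with lookup p x | lookup q x
  ... | true  | true  = refl
  ... | true  | false = refl
  ... | false | _     = refl

  χ·χ≡∣∩∣ : (p q : Subset n) → sum (λ y → χ p y * χ q y) ≡ + ∣ p ∩ q ∣
  χ·χ≡∣∩∣ p q = trans (sum-cong-≗ λ y → sym (χ-∩ p q y)) (sum-χ (p ∩ q))

  annihilates-inner : (A : Fin m → Fin n → ℤ) (c : Fin m → ℤ) → (∀ y → sum (λ i → c i * A i y) ≡ 0ℤ) →
    (w : Fin n → ℤ) → sum (λ i → c i * sum (λ y → A i y * w y)) ≡ 0ℤ
  annihilates-inner {n = n} A c cA≡0 w = begin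
    sum (λ i → c i * sum (λ y → A i y * w y))
      ≡⟨ sum-cong-≗ (λ i → *-distribˡ-sum (c i) (λ y → A i y * w y)) ⟩
    sum (λ i → sum (λ y → c i * (A i y * w y)))
      ≡⟨ ∑-comm (λ i y → c i * (A i y * w y)) ⟩
    sum (λ y → sum (λ i → c i * (A i y * w y)))
      ≡⟨ sum-cong-≗ (λ y → trans (sum-cong-≗ λ i → sym (*-assoc (c i) (A i y) (w y)))
                                 (sym (*-distribʳ-sum (w y) (λ i → c i * A i y)))) ⟩
    sum (λ y → sum (λ i → c i * A i y) * w y)
      ≡⟨ sum-cong-≗ (λ y → cong (_* w y) (cA≡0 y)) ⟩
    sum (λ y → 0ℤ * w y)
      ≡⟨ sum-replicate-zero n ⟩
    0ℤ ∎
    where open ≡-Reasoning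

open IntegerLinearAlgebra

-- Integer arithmetic is opened only inside the module above, so from here on _+_, _≤_ and _<_
-- are the operations on ℕ used by the statement.
open import Data.Nat using (_+_; _∸_; _≤_; _<_)

∣p∪⁅x⁆∣≡1+∣p∣ : x ∉ p → ∣ p ∪ ⁅ x ⁆ ∣ ≡ suc ∣ p ∣
∣p∪⁅x⁆∣≡1+∣p∣ {x = zero}  {outside ∷ p} _   = cong suc (cong ∣_∣ (∪-identityʳ p))
∣p∪⁅x⁆∣≡1+∣p∣ {x = zero}  {inside  ∷ p} x∉p = contradiction here x∉p
∣p∪⁅x⁆∣≡1+∣p∣ {x = suc x} {outside ∷ p} x∉p = ∣p∪⁅x⁆∣≡1+∣p∣ (x∉p ∘ there)
∣p∪⁅x⁆∣≡1+∣p∣ {x = suc x} {inside  ∷ p} x∉p = cong suc (∣p∪⁅x⁆∣≡1+∣p∣ (x∉p ∘ there))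

∃∈q∖p-there : ∀ {s r} → ∃[ x ] x ∈ q × x ∉ p → ∃[ x ] x ∈ s ∷ q × x ∉ r ∷ p
∃∈q∖p-there (x , x∈q , x∉p) = suc x , there x∈q , x∉p ∘ drop-there

∣p∣<∣q∣⇒∃∈q∖p : ∀ (p q : Subset n) → ∣ p ∣ < ∣ q ∣ → ∃[ x ] x ∈ q × x ∉ p
∣p∣<∣q∣⇒∃∈q∖p (outside ∷ p) (inside ∷ q) _ = zero , here , λ ()
∣p∣<∣q∣⇒∃∈q∖p (outside ∷ p) (outside ∷ q) ∣p∣<∣q∣ = ∃∈q∖p-there (∣p∣<∣q∣⇒∃∈q∖p p q ∣p∣<∣q∣)
∣p∣<∣q∣⇒∃∈q∖p (inside ∷ p) (inside ∷ q) (s≤s ∣p∣<∣q∣) = ∃∈q∖p-there (∣p∣<∣q∣⇒∃∈q∖p p q ∣p∣<∣q∣)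
∣p∣<∣q∣⇒∃∈q∖p (inside ∷ p) (outside ∷ q) ∣p∣<∣q∣ = ∃∈q∖p-there (∣p∣<∣q∣⇒∃∈q∖p p q (ℕ.<-trans (ℕ.n<1+n _) ∣p∣<∣q∣))

∃-∉ : ∀ {n} {p : Subset n} → ∣ p ∣ < n → ∃[ x ] x ∉ p
∃-∉ {n} {p} ∣p∣<n with x , _ , x∉p ← ∣p∣<∣q∣⇒∃∈q∖p p ⊤ (subst (∣ p ∣ <_) (sym (∣⊤∣≡n n)) ∣p∣<n) = x , x∉p

∃-∈ : ∀ {n} {p : Subset n} → 0 < ∣ p ∣ → ∃[ x ] x ∈ p
∃-∈ {n} {p} 0<∣p∣ with x , x∈p , _ ← ∣p∣<∣q∣⇒∃∈q∖p ⊥ p (subst (_< ∣ p ∣) (sym (∣⊥∣≡0 n)) 0<∣p∣) = x , x∈p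

x∈p⇒⁅x⁆⊆p : x ∈ p → ⁅ x ⁆ ⊆ p
x∈p⇒⁅x⁆⊆p {x = x} x∈p y∈⁅x⁆ = subst (_∈ _) (sym (x∈⁅y⁆⇒x≡y x y∈⁅x⁆)) x∈p

∪⁅⁆-⊆ : p ⊆ q → x ∈ q → p ∪ ⁅ x ⁆ ⊆ q
∪⁅⁆-⊆ {p = p} p⊆q x∈q = [ p⊆q , x∈p⇒⁅x⁆⊆p x∈q ] ∘ x∈p∪q⁻ p _

extend-within : ∀ d → p ⊆ q → ∣ p ∣ + d ≤ ∣ q ∣ → ∃[ r ] p ⊆ r × r ⊆ q × ∣ r ∣ ≡ ∣ p ∣ + d
extend-within {p = p} zero p⊆q _ = p , (λ x∈p → x∈p) , p⊆q , sym (ℕ.+-identityʳ _)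
extend-within {p = p} {q} (suc d) p⊆q room
  with x , x∈q , x∉p ← ∣p∣<∣q∣⇒∃∈q∖p p q (ℕ.<-≤-trans (ℕ.m<m+n _ ℕ.z<s) room)
  = lift (extend-within d (∪⁅⁆-⊆ p⊆q x∈q) room′)
  where
  ∣p∪⁅x⁆∣+d≡∣p∣+1+d : ∣ p ∪ ⁅ x ⁆ ∣ + d ≡ ∣ p ∣ + suc d
  ∣p∪⁅x⁆∣+d≡∣p∣+1+d = trans (cong (_+ d) (∣p∪⁅x⁆∣≡1+∣p∣ x∉p)) (sym (ℕ.+-suc ∣ p ∣ d))
  room′ : ∣ p ∪ ⁅ x ⁆ ∣ + d ≤ ∣ q ∣
  room′ = subst (_≤ ∣ q ∣) (sym ∣p∪⁅x⁆∣+d≡∣p∣+1+d) room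
  lift : ∃[ r ] p ∪ ⁅ x ⁆ ⊆ r × r ⊆ q × ∣ r ∣ ≡ ∣ p ∪ ⁅ x ⁆ ∣ + d →
         ∃[ r ] p ⊆ r × r ⊆ q × ∣ r ∣ ≡ ∣ p ∣ + suc d
  lift (r , p∪⁅x⁆⊆r , r⊆q , ∣r∣) = r , p∪⁅x⁆⊆r ∘ p⊆p∪q _ , r⊆q , trans ∣r∣ ∣p∪⁅x⁆∣+d≡∣p∣+1+d

∃-subset-of-size : ∀ {j} → j ≤ n → ∃ λ (p : Subset n) → ∣ p ∣ ≡ j
∃-subset-of-size {n} {j} j≤n
  with p , _ , _ , ∣p∣ ← extend-within {p = ⊥ {n}} {q = ⊤} j ⊆⊤
                           (subst₂ _≤_ (cong (_+ j) (sym (∣⊥∣≡0 n))) (sym (∣⊤∣≡n n)) j≤n)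
  = p , trans ∣p∣ (cong (_+ j) (∣⊥∣≡0 n))

[p∪q]∪[p∪r]≡[p∪q]∪r : (p q r : Subset n) → (p ∪ q) ∪ (p ∪ r) ≡ (p ∪ q) ∪ r
[p∪q]∪[p∪r]≡[p∪q]∪r {n} p q r = prove 3 ((P ⊕ Q) ⊕ (P ⊕ R)) ((P ⊕ Q) ⊕ R) (p ∷ q ∷ r ∷ [])
  where
  open ICM (∪-idempotentCommutativeMonoid n)
  P Q R : Expr 3
  P = var zero
  Q = var (suc zero)
  R = var (suc (suc zero))

∃-separating-set : ∀ k {a b : Fin n} → a ≢ b → suc (suc k) ≤ n → ∃ λ Q → a ∈ Q × b ∉ Q × ∣ Q ∣ ≡ suc k
∃-separating-set {n} k {a} {b} a≢b 2+k≤n = separating (extend-within k ⁅a⁆⊆∁⁅b⁆ room)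
  where
  ⁅a⁆⊆∁⁅b⁆ : ⁅ a ⁆ ⊆ ∁ ⁅ b ⁆
  ⁅a⁆⊆∁⁅b⁆ x∈⁅a⁆ = x∉p⇒x∈∁p (x≢y⇒x∉⁅y⁆ λ { refl → a≢b (sym (x∈⁅y⁆⇒x≡y a x∈⁅a⁆)) })
  room : ∣ ⁅ a ⁆ ∣ + k ≤ ∣ ∁ ⁅ b ⁆ ∣
  room = subst₂ _≤_ (cong (_+ k) (sym (∣⁅x⁆∣≡1 a)))
                    (sym (trans (∣∁p∣≡n∸∣p∣ ⁅ b ⁆) (cong (n ∸_) (∣⁅x⁆∣≡1 b))))
                    (ℕ.∸-monoˡ-≤ 1 2+k≤n)
  separating : ∃[ Q ] ⁅ a ⁆ ⊆ Q × Q ⊆ ∁ ⁅ b ⁆ × ∣ Q ∣ ≡ ∣ ⁅ a ⁆ ∣ + k →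
               ∃ λ Q → a ∈ Q × b ∉ Q × ∣ Q ∣ ≡ suc k
  separating (Q , ⁅a⁆⊆Q , Q⊆∁⁅b⁆ , ∣Q∣) =
    Q , ⁅a⁆⊆Q (x∈⁅x⁆ a) , (λ b∈Q → x∈∁p⇒x∉p (Q⊆∁⁅b⁆ b∈Q) (x∈⁅x⁆ b)) , trans ∣Q∣ (cong (_+ k) (∣⁅x⁆∣≡1 a))

disjoint⇒∣∩∣≡0 : (∀ {x} → x ∈ p → x ∉ q) → ∣ p ∩ q ∣ ≡ 0
disjoint⇒∣∩∣≡0 {n} {p} {q} disjoint =
  trans (cong ∣_∣ (Empty-unique λ (x , x∈p∩q) → let x∈p , x∈q = x∈p∩q⁻ p q x∈p∩q in disjoint x∈p x∈q))
        (∣⊥∣≡0 n)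

allFin-true⁻ : ∀ {p : Fin n → Bool} → allFin p ≡ true → ∀ i → p i ≡ true
allFin-true⁻ {p = p} all≡true zero with p zero | all≡true
... | true | _ = refl
allFin-true⁻ {p = p} all≡true (suc i) with p zero | all≡true
... | true | rest≡true = allFin-true⁻ rest≡true i

allFin-true⁺ : ∀ {p : Fin n → Bool} → (∀ i → p i ≡ true) → allFin p ≡ true
allFin-true⁺ {zero}      _      = refl
allFin-true⁺ {suc n} {p} p≡true rewrite p≡true zero = allFin-true⁺ (p≡true ∘ suc)

module _ (D : Digraph n) where

  ∈-commonOut⁻ : y ∈ commonOut D S → x ∈ S → arc D x y ≡ true
  ∈-commonOut⁻ {y = y} {x = x} y∈ x∈S =
    subst (λ s → not s ∨ arc D x y ≡ true) ([]=⇒lookup x∈S)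
      (allFin-true⁻ (trans (sym (lookup∘tabulate _ y)) ([]=⇒lookup y∈)) x)

  ∈-commonOut⁺ : (∀ {x} → x ∈ S → arc D x y ≡ true) → y ∈ commonOut D S
  ∈-commonOut⁺ {S = S} {y = y} arcs = lookup⇒[]= y _ (trans (lookup∘tabulate _ y) (allFin-true⁺ arc-or-outside))
    where
    arc-or-outside : ∀ x → not (lookup S x) ∨ arc D x y ≡ true
    arc-or-outside x with lookup S x in eq
    ... | true  = arcs (lookup⇒[]= x S eq)
    ... | false = refl

  commonOut-antitone : S ⊆ T → commonOut D T ⊆ commonOut D S
  commonOut-antitone S⊆T y∈ = ∈-commonOut⁺ (∈-commonOut⁻ y∈ ∘ S⊆T)

  ∈⇒∉-commonOut : x ∈ S → x ∉ commonOut D S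
  ∈⇒∉-commonOut {x = x} x∈S x∈ = contradiction (trans (sym (∈-commonOut⁻ x∈ x∈S)) (loopless D x)) λ ()

  commonOut-∪ : (S T : Subset n) → commonOut D (S ∪ T) ≡ commonOut D S ∩ commonOut D T
  commonOut-∪ S T = ⊆-antisym
    (λ y∈ → x∈p∩q⁺ (commonOut-antitone (p⊆p∪q {p = S} T) y∈ , commonOut-antitone (q⊆p∪q S T) y∈))
    (λ y∈ → let y∈S , y∈T = x∈p∩q⁻ _ _ y∈ in
      ∈-commonOut⁺ ([ ∈-commonOut⁻ y∈S , ∈-commonOut⁻ y∈T ] ∘ x∈p∪q⁻ S T))

IsComplete : Digraph n → Set
IsComplete D = ∀ a b → a ≢ b → arc D a b ≡ true

module _ {D : Digraph n} (complete-D : IsComplete D) where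

  commonOut-complete : (S : Subset n) → commonOut D S ≡ ∁ S
  commonOut-complete S = ⊆-antisym
    (λ y∈ → x∉p⇒x∈∁p (λ y∈S → ∈⇒∉-commonOut D y∈S y∈))
    (λ y∈∁S → ∈-commonOut⁺ D λ x∈S → complete-D _ _ λ { refl → x∈∁p⇒x∉p y∈∁S x∈S })

  ≅-complete : D ≅ complete n
  ≅-complete = record { bij = ⤖-id (Fin n) ; preserve = arcs }
    where
    arcs : ∀ x y → arc (complete n) x y ≡ arc D x y
    arcs x y with x ≟ y
    ... | yes refl = sym (loopless D x)
    ... | no x≢y   = sym (complete-D x y x≢y)

module Liking {n} (D : Digraph n) {t l : ℕ} (liking : IsLiking t l D) (0<l : 0 < l) (t≤n : t ≤ n) where

  l<∣commonOut∣ : ∀ {T} → suc ∣ T ∣ ≡ t → l < ∣ commonOut D T ∣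
  l<∣commonOut∣ {T} ∣T∣+1≡t
    with u , u∉T ← ∃-∉ (ℕ.≤-trans (ℕ.≤-reflexive ∣T∣+1≡t) t≤n)
    with y , y∈co[T∪⁅u⁆] ← ∃-∈ (subst (0 <_)
                                   (sym (liking (T ∪ ⁅ u ⁆) (trans (∣p∪⁅x⁆∣≡1+∣p∣ {p = T} u∉T) ∣T∣+1≡t))) 0<l)
    = subst (_< ∣ commonOut D T ∣) (liking (T ∪ ⁅ y ⁆) (trans (∣p∪⁅x⁆∣≡1+∣p∣ {p = T} y∉T) ∣T∣+1≡t))
        (p⊂q⇒∣p∣<∣q∣ (commonOut-antitone D (p⊆p∪q {p = T} ⁅ y ⁆) , y , y∈coT , y∉co[T∪⁅y⁆]))
    where
    y∈coT : y ∈ commonOut D T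
    y∈coT = commonOut-antitone D (p⊆p∪q {p = T} ⁅ u ⁆) y∈co[T∪⁅u⁆]
    y∉T : y ∉ T
    y∉T y∈T = ∈⇒∉-commonOut D y∈T y∈coT
    y∉co[T∪⁅y⁆] : y ∉ commonOut D (T ∪ ⁅ y ⁆)
    y∉co[T∪⁅y⁆] = ∈⇒∉-commonOut D (x∈p∪q⁺ {p = T} (inj₂ (x∈⁅x⁆ y)))

  module Rows {Q : Subset n} (∣Q∣+2≡t : suc (suc ∣ Q ∣) ≡ t) where

    row : Fin n → Subset n
    row i with i ∈? Q
    ... | yes _ = ⁅ i ⁆
    ... | no  _ = commonOut D (Q ∪ ⁅ i ⁆)

    A : Fin n → Fin n → ℤ
    A i = χ (row i)

    A-supportedOn : SupportedOn A (Q ∪ commonOut D Q)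
    A-supportedOn i y y∉ = χ-∉ (y∉ ∘ row⊆ i)
      where
      row⊆ : ∀ i → row i ⊆ Q ∪ commonOut D Q
      row⊆ i with i ∈? Q
      ... | yes i∈Q = λ y∈⁅i⁆ → x∈p∪q⁺ (inj₁ (x∈p⇒⁅x⁆⊆p i∈Q y∈⁅i⁆))
      ... | no  _   = λ y∈ → x∈p∪q⁺ (inj₂ (commonOut-antitone D (p⊆p∪q {p = Q} ⁅ i ⁆) y∈))

    gram : Fin n → Fin n → ℤ
    gram i p = sum λ y → A i y ℤ.* A p y

    u : Fin n → ℤ
    u i with i ∈? Q
    ... | yes _ = 0ℤ
    ... | no  _ = 1ℤ

    ∣Q∪⁅p⁆∣+1≡t : ∀ {p} → p ∉ Q → suc ∣ Q ∪ ⁅ p ⁆ ∣ ≡ t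
    ∣Q∪⁅p⁆∣+1≡t p∉Q = trans (cong suc (∣p∪⁅x⁆∣≡1+∣p∣ p∉Q)) ∣Q∣+2≡t

    e : Fin n → ℤ
    e p with p ∈? Q
    ... | yes _ = 1ℤ
    ... | no  _ = + (∣ commonOut D (Q ∪ ⁅ p ⁆) ∣ ∸ l)

    0<e : ∀ p → 0ℤ ℤ.< e p
    0<e p with p ∈? Q
    ... | yes _   = +<+ ℕ.z<s
    ... | no  p∉Q = +<+ (ℕ.m<n⇒0<n∸m (l<∣commonOut∣ {Q ∪ ⁅ p ⁆} (∣Q∪⁅p⁆∣+1≡t p∉Q)))

    gram-diagonal : ∀ p → gram p p ≡ + l ℤ.* (u p ℤ.* u p) ℤ.+ e p
    gram-diagonal p = trans (χ·χ≡∣∩∣ (row p) (row p)) (trans (cong (+_ ∘ ∣_∣) (∩-idem (row p))) diagonal)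
      where
      diagonal : + ∣ row p ∣ ≡ + l ℤ.* (u p ℤ.* u p) ℤ.+ e p
      diagonal with p ∈? Q
      ... | yes _   = trans (cong +_ (∣⁅x⁆∣≡1 p)) (sym (cong (ℤ._+ 1ℤ) (*-zeroʳ (+ l))))
      ... | no  p∉Q = sym (begin
        + l ℤ.* 1ℤ ℤ.+ + (∣co∣ ∸ l)  ≡⟨ cong (ℤ._+ + (∣co∣ ∸ l)) (*-identityʳ (+ l)) ⟩
        + l ℤ.+ + (∣co∣ ∸ l)         ≡⟨ pos-+ l (∣co∣ ∸ l) ⟨
        + (l + (∣co∣ ∸ l))           ≡⟨ cong +_ (ℕ.m+[n∸m]≡n (ℕ.<⇒≤ (l<∣commonOut∣ {Q ∪ ⁅ p ⁆} (∣Q∪⁅p⁆∣+1≡t p∉Q)))) ⟩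
        + ∣co∣                       ∎)
        where
        open ≡-Reasoning
        ∣co∣ : ℕ
        ∣co∣ = ∣ commonOut D (Q ∪ ⁅ p ⁆) ∣

    gram-off-diagonal : ∀ i p → i ≢ p → gram i p ≡ + l ℤ.* (u i ℤ.* u p)
    gram-off-diagonal i p i≢p = trans (χ·χ≡∣∩∣ (row i) (row p)) off-diagonal
      where
      Q-∉-commonOut : ∀ {x y} → x ∈ Q → x ∉ commonOut D (Q ∪ ⁅ y ⁆)
      Q-∉-commonOut x∈Q = ∈⇒∉-commonOut D (x∈p∪q⁺ (inj₁ x∈Q))
      p∉Q∪⁅i⁆ : p ∉ Q → p ∉ Q ∪ ⁅ i ⁆
      p∉Q∪⁅i⁆ p∉Q = [ p∉Q , (λ p∈⁅i⁆ → i≢p (sym (x∈⁅y⁆⇒x≡y i p∈⁅i⁆))) ] ∘ x∈p∪q⁻ Q ⁅ i ⁆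
      off-diagonal : + ∣ row i ∩ row p ∣ ≡ + l ℤ.* (u i ℤ.* u p)
      off-diagonal with i ∈? Q | p ∈? Q
      ... | yes i∈Q | yes _ = trans (cong +_ (disjoint⇒∣∩∣≡0 λ x∈⁅i⁆ x∈⁅p⁆ →
                                i≢p (trans (sym (x∈⁅y⁆⇒x≡y i x∈⁅i⁆)) (x∈⁅y⁆⇒x≡y p x∈⁅p⁆))))
                              (sym (*-zeroʳ (+ l)))
      ... | yes i∈Q | no _  = trans (cong +_ (disjoint⇒∣∩∣≡0 (Q-∉-commonOut ∘ x∈p⇒⁅x⁆⊆p i∈Q)))
                              (sym (*-zeroʳ (+ l)))
      ... | no _ | yes p∈Q  = trans (cong +_ (disjoint⇒∣∩∣≡0 λ x∈co x∈⁅p⁆ →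
                                Q-∉-commonOut {y = i} (x∈p⇒⁅x⁆⊆p p∈Q x∈⁅p⁆) x∈co))
                              (sym (*-zeroʳ (+ l)))
      ... | no i∉Q | no p∉Q = trans (cong +_ ∣co∩co∣≡l) (sym (*-identityʳ (+ l)))
        where
        ∣co∩co∣≡l : ∣ commonOut D (Q ∪ ⁅ i ⁆) ∩ commonOut D (Q ∪ ⁅ p ⁆) ∣ ≡ l
        ∣co∩co∣≡l = begin
          ∣ commonOut D (Q ∪ ⁅ i ⁆) ∩ commonOut D (Q ∪ ⁅ p ⁆) ∣
            ≡⟨ cong ∣_∣ (commonOut-∪ D (Q ∪ ⁅ i ⁆) (Q ∪ ⁅ p ⁆)) ⟨
          ∣ commonOut D ((Q ∪ ⁅ i ⁆) ∪ (Q ∪ ⁅ p ⁆)) ∣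
            ≡⟨ cong (∣_∣ ∘ commonOut D) ([p∪q]∪[p∪r]≡[p∪q]∪r Q ⁅ i ⁆ ⁅ p ⁆) ⟩
          ∣ commonOut D ((Q ∪ ⁅ i ⁆) ∪ ⁅ p ⁆) ∣
            ≡⟨ liking ((Q ∪ ⁅ i ⁆) ∪ ⁅ p ⁆) (trans (∣p∪⁅x⁆∣≡1+∣p∣ (p∉Q∪⁅i⁆ p∉Q)) (∣Q∪⁅p⁆∣+1≡t i∉Q)) ⟩
          l ∎
          where open ≡-Reasoning

    rows-independent : ¬ Dependency A
    rows-independent record { coeff = c ; nontrivial = i , cᵢ≢0 ; annihilates = cA≡0 } = cᵢ≢0
      (rank-one+positive-diagonal-nonsingular l u e gram gram-off-diagonal gram-diagonal 0<e c
        (annihilates-inner A c cA≡0 ∘ A) i)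

  Q∪commonOut-Q-covers : ∀ {Q} → suc (suc ∣ Q ∣) ≡ t → ∀ b → b ∈ Q ∪ commonOut D Q
  Q∪commonOut-Q-covers {Q} ∣Q∣+2≡t b with b ∈? Q ∪ commonOut D Q
  ... | yes b∈ = b∈
  ... | no  b∉ = contradiction (dependency A (Q ∪ commonOut D Q) A-supportedOn ∣support∣<n) rows-independent
    where
    open Rows {Q} ∣Q∣+2≡t
    ∣support∣<n : ∣ Q ∪ commonOut D Q ∣ < n
    ∣support∣<n = subst (∣ Q ∪ commonOut D Q ∣ <_) (∣⊤∣≡n n) (p⊂q⇒∣p∣<∣q∣ (⊆⊤ , b , ∈⊤ , b∉))

  isComplete : 3 ≤ t → IsComplete D
  isComplete 3≤t a b a≢b
    with k , 3+k≡t ← ℕ.m≤n⇒∃[o]m+o≡n 3≤t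
    with Q , a∈Q , b∉Q , ∣Q∣ ← ∃-separating-set k a≢b (ℕ.≤-trans (ℕ.n≤1+n _) (subst (_≤ n) (sym 3+k≡t) t≤n))
    with Q∪commonOut-Q-covers (trans (cong (_+_ 2) ∣Q∣) 3+k≡t) b
  ... | b∈ = [ (λ b∈Q → contradiction b∈Q b∉Q) , (λ b∈coQ → ∈-commonOut⁻ D b∈coQ a∈Q) ] (x∈p∪q⁻ Q _ b∈)

  order : IsComplete D → n ≡ t + l
  order complete-D with S , ∣S∣ ← ∃-subset-of-size t≤n = begin
    n                   ≡⟨ ℕ.m+[n∸m]≡n t≤n ⟨
    t + (n ∸ t)         ≡⟨ cong (λ s → t + (n ∸ s)) ∣S∣ ⟨
    t + (n ∸ ∣ S ∣)     ≡⟨ cong (_+_ t) (∣∁p∣≡n∸∣p∣ S) ⟨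
    t + ∣ ∁ S ∣         ≡⟨ cong (λ s → t + ∣ s ∣) (commonOut-complete {D = D} complete-D S) ⟨
    t + ∣ commonOut D S ∣ ≡⟨ cong (_+_ t) (liking S ∣S∣) ⟩
    t + l ∎
    where open ≡-Reasoning

theorem4p3 : (t l : ℕ) → 1 ≤ l → l < t → 3 ≤ t →
    (n : ℕ) → t ≤ n → (D : Digraph n) → IsLiking t l D → D ≅ complete (t + l)
theorem4p3 t l 1≤l _ 3≤t n t≤n D liking =
  subst (λ m → D ≅ complete m) (order complete-D) (≅-complete complete-D)
  where
  open Liking D liking 1≤l t≤n
  complete-D : IsComplete D
  complete-D = isComplete 3≤t
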